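{- (Reconstruction-by-Separation) Let $G$ and $G'$ be graphs with clean clique separations $(A,C,B)$ and $(A',C',B')$, respectively. If $H_A\cong H_{A'}$ and $H_B\cong H_{B'}$ as annotated graphs, then $G\cong G'$.
   Context: A separation of $G$ is an ordered partition $(A,C,B)$ of $V(G)$ with no edges between $A$ and $B$; it is a clean clique separation if there is an interval representation $\{[\ell_v,r_v]\}$ of $G$ (distinct vertices adjacent iff intervals intersect) with $\emptyset\neq\bigcap_{c\in C}[\ell_c,r_c]\subseteq(\max_{a\in A}r_a,\min_{b\in B}\ell_b)$. An annotated graph is a pair $(H,\lambda)$ with $\lambda: V(H)\to\mathbb{N}\cup\{\bot\}$; an isomorphism of annotated graphs $(H_1,\lambda_1)\to(H_2,\lambda_2)$ is a graph isomorphism $\varphi$ with $\lambda_2(\varphi(h))=\lambda_1(h)$ for all $h$. For a clean clique separation $(A,C,B)$ of $G$ and $X\in\{A,B\}$, $H_X$ is the annotated graph $(G[X\cup C],\lambda_X)$ with $\lambda_X(h)=\bot$ if $h\notin C$ and $\lambda_X(h)=\deg_G(h)$ if $h\in C$.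
   Formalization: The interval representations witnessing the clean clique separations of G and G' have rational endpoints instead of real ones. -}

module Defs where

open import Data.Nat using (ℕ)
open import Data.Bool using (Bool; true; false; if_then_else_)
open import Data.Fin using (Fin)
open import Data.List using (map; allFin)
open import Data.Nat.ListAction using (sum)
open import Data.Maybe using (Maybe; just; nothing)
open import Data.Rational using (ℚ; _≤_; _<_)
open import Data.Product using (Σ; ∃; _×_)
open import Data.Sum using (_⊎_)
open import Function.Bundles using (_↔_; Inverse)
open import Relation.Binary.PropositionalEquality using (_≡_; _≢_)
open import Relation.Nullary using (¬_)

record Graph : Set where
  field
    n     : ℕ
    adj   : Fin n → Fin n → Bool
    sym   : ∀ u v → adj u v ≡ adj v u
    irrefl : ∀ v → adj v v ≡ false
open Graph public

deg : (G : Graph) → Fin (n G) → ℕ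
deg G v = sum (map (λ u → if adj G v u then 1 else 0) (allFin (n G)))

_≅_ : Graph → Graph → Set
G ≅ G' = Σ (Fin (n G) ↔ Fin (n G')) λ φ →
  ∀ u v → adj G' (Inverse.to φ u) (Inverse.to φ v) ≡ adj G u v

-- Annotated graphs (H, λ), λ : V(H) → ℕ ∪ {⊥}, with ⊥ = nothing.
record AGraph : Set₁ where
  field
    V     : Set
    E     : V → V → Bool
    label : V → Maybe ℕ

_≅ₐ_ : AGraph → AGraph → Set
H₁ ≅ₐ H₂ = Σ (AGraph.V H₁ ↔ AGraph.V H₂) λ φ →
  (∀ u v → AGraph.E H₂ (Inverse.to φ u) (Inverse.to φ v) ≡ AGraph.E H₁ u v)
  × (∀ h → AGraph.label H₂ (Inverse.to φ h) ≡ AGraph.label H₁ h)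

-- Ordered partition (A, C, B) of V(G), given by assigning each vertex a part.
data Part : Set where
  pA pC pB : Part

Partition : Graph → Set
Partition G = Fin (n G) → Part

IsSeparation : (G : Graph) → Partition G → Set
IsSeparation G s = ∀ u v → s u ≡ pA → s v ≡ pB → adj G u v ≡ false

record IntervalRep (G : Graph) : Set where
  field
    ℓ r      : Fin (n G) → ℚ
    ℓ≤r      : ∀ v → ℓ v ≤ r v
    adj→meet : ∀ u v → u ≢ v → adj G u v ≡ true →
                 ∃ λ x → (ℓ u ≤ x × x ≤ r u) × (ℓ v ≤ x × x ≤ r v)
    meet→adj : ∀ u v → u ≢ v →
                 (∃ λ x → (ℓ u ≤ x × x ≤ r u) × (ℓ v ≤ x × x ≤ r v)) →
                 adj G u v ≡ true
open IntervalRep public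

InCliqueMeet : {G : Graph} → Partition G → IntervalRep G → ℚ → Set
InCliqueMeet {G} s R x = ∀ c → s c ≡ pC → ℓ R c ≤ x × x ≤ r R c

-- x ∈ (max_{a∈A} r_a, min_{b∈B} ℓ_b)   (max ∅ = -∞, min ∅ = +∞)
InGap : {G : Graph} → Partition G → IntervalRep G → ℚ → Set
InGap {G} s R x = (∀ a → s a ≡ pA → r R a < x) × (∀ b → s b ≡ pB → x < ℓ R b)

IsCleanCliqueSeparation : (G : Graph) → Partition G → Set
IsCleanCliqueSeparation G s =
  IsSeparation G s ×
  Σ (IntervalRep G) λ R →
    (∃ λ x → InCliqueMeet s R x) × (∀ x → InCliqueMeet s R x → InGap s R x)

InXC : Part → Part → Set
InXC X p = p ≡ X ⊎ p ≡ pC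

labelX : (G : Graph) → Partition G → Fin (n G) → Maybe ℕ
labelX G s v with s v
... | pC = just (deg G v)
... | _  = nothing

H : (G : Graph) → Partition G → Part → AGraph
H G s X = record
  { V     = Σ (Fin (n G)) (λ v → InXC X (s v))
  ; E     = λ u v → adj G (Σ.proj₁ u) (Σ.proj₁ v)
  ; label = λ v → labelX G s (Σ.proj₁ v)
  }

-- Glue the isomorphism H_A ≅ H_A' on A ∪ C to the isomorphism H_B ≅ H_B' on B; the
-- annotations force both to respect the parts. The only edges seen by neither of them join
-- a vertex c ∈ C, moved by the A-side map to c', to a vertex of B. In a clean clique separation
-- the B-neighbourhoods of the vertices of C are nested (ordered by right endpoints, as every
-- interval of B starts to the right of a common point of the intervals of C), so each is
-- determined by its size. The B-degree of c' is its degree, the annotation, minus its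
-- (A ∪ C)-degree, both of which H_A sees; so it equals the B-degree of c and hence of the
-- B-side image of c, which has the correct B-neighbours.
module Submission where

open import Defs hiding (sym)
open import Data.Bool using (Bool; true; false; T; _∧_; not; if_then_else_)
open import Data.Bool.Properties using (T-∧; T-≡)
open import Data.Empty using (⊥-elim)
open import Data.Fin using (Fin; zero; suc)
open import Data.Fin.Permutation using (↔⇒≡)
open import Data.Fin.Properties using (+↔⊎)
open import Data.List using (tabulate)
open import Data.List.Properties using (map-tabulate)
open import Data.Maybe using (Maybe; just; nothing)
open import Data.Maybe.Properties using (just-injective)
open import Data.Nat using (ℕ; zero; suc; _+_; _≤_; z≤n)
open import Data.Nat.ListAction using (sum)
import Data.Nat.Properties as ℕ
open import Algebra.Properties.CommutativeSemigroup ℕ.+-commutativeSemigroup using (interchange)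
open import Data.Product using (Σ; _×_; _,_; proj₁; proj₂)
open import Data.Product.Function.Dependent.Propositional using (Σ-↔)
open import Data.Rational as ℚ using (ℚ)
import Data.Rational.Properties as ℚₚ
open import Data.Sum as Sum using (_⊎_; inj₁; inj₂)
open import Data.Sum.Function.Propositional using (_⊎-↔_)
open import Data.Unit using (tt)
open import Function using (_∘_; id)
open import Function.Bundles using (_↔_; mk↔ₛ′; Inverse; Equivalence)
open import Function.Properties.Inverse using (↔-refl; ↔-sym; ↔-trans)
open import Relation.Binary.PropositionalEquality
open import Relation.Nullary using (Irrelevant)
open import Relation.Unary using (_⊆_)

open AGraph using (V)

private variable
  k m : ℕ
  A : Set
  X : Part

-- Phrased with if_then_else_ so that deg unfolds to a count.
indicator : Bool → ℕ
indicator b = if b then 1 else 0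

count : (Fin k → Bool) → ℕ
count f = sum (tabulate (indicator ∘ f))

indicator-injective : ∀ {a b} → indicator a ≡ indicator b → a ≡ b
indicator-injective {false} {false} _ = refl
indicator-injective {true}  {true}  _ = refl

indicator-mono : ∀ {a b} → (T a → T b) → indicator a ≤ indicator b
indicator-mono {false}         _   = z≤n
indicator-mono {true}  {true}  _   = ℕ.≤-refl
indicator-mono {true}  {false} a⇒b = ⊥-elim (a⇒b tt)

indicator-partition : ∀ a b → indicator b ≡ indicator (a ∧ b) + indicator (not a ∧ b)
indicator-partition true  true  = refl
indicator-partition true  false = refl
indicator-partition false true  = refl
indicator-partition false false = refl

+-≤-≡⇒≡ : ∀ {a b c d} → a ≤ b → c ≤ d → a + c ≡ b + d → a ≡ b × c ≡ d
+-≤-≡⇒≡ {a} {b} {c} {d} a≤b c≤d eq = a≡b , ℕ.+-cancelˡ-≡ a c d (trans eq (cong (_+ d) (sym a≡b)))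
  where
  a≡b : a ≡ b
  a≡b = ℕ.≤-antisym a≤b (ℕ.+-cancelʳ-≤ c b a (ℕ.≤-trans (ℕ.+-monoʳ-≤ b c≤d) (ℕ.≤-reflexive (sym eq))))

count-mono : {f g : Fin k → Bool} → T ∘ f ⊆ T ∘ g → count f ≤ count g
count-mono {zero}  f⊆g = z≤n
count-mono {suc k} {f} {g} f⊆g =
  ℕ.+-mono-≤ (indicator-mono {f zero} {g zero} f⊆g) (count-mono {f = f ∘ suc} {g ∘ suc} f⊆g)

⊆∧count≡⇒≗ : {f g : Fin k → Bool} → T ∘ f ⊆ T ∘ g → count f ≡ count g → f ≗ g
⊆∧count≡⇒≗ {suc k} {f} {g} f⊆g eq i
  with +-≤-≡⇒≡ (indicator-mono {f zero} {g zero} f⊆g) (count-mono {f = f ∘ suc} {g ∘ suc} f⊆g) eq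
... | head≡ , tail≡ with i
...   | zero  = indicator-injective head≡
...   | suc j = ⊆∧count≡⇒≗ {f = f ∘ suc} {g ∘ suc} f⊆g tail≡ j

count-partition : (p f : Fin k → Bool) →
  count f ≡ count (λ u → p u ∧ f u) + count (λ u → not (p u) ∧ f u)
count-partition {zero}  p f = refl
count-partition {suc k} p f =
  trans (cong₂ _+_ (indicator-partition (p zero) (f zero)) (count-partition (p ∘ suc) (f ∘ suc)))
        (interchange (indicator (p zero ∧ f zero)) (indicator (not (p zero) ∧ f zero))
                     (count (λ u → p (suc u) ∧ f (suc u))) (count (λ u → not (p (suc u)) ∧ f (suc u))))

Σ-Fin-suc↔ : {P : Fin (suc k) → Set} → Σ (Fin (suc k)) P ↔ (P zero ⊎ Σ (Fin k) (P ∘ suc))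
Σ-Fin-suc↔ = mk↔ₛ′
  (λ { (zero , p) → inj₁ p ; (suc i , p) → inj₂ (i , p) })
  (λ { (inj₁ p) → zero , p ; (inj₂ (i , p)) → suc i , p })
  (λ { (inj₁ _) → refl ; (inj₂ _) → refl })
  (λ { (zero , _) → refl ; (suc _ , _) → refl })

T↔Fin-indicator : (b : Bool) → T b ↔ Fin (indicator b)
T↔Fin-indicator true  = mk↔ₛ′ (λ _ → zero) (λ _ → tt) (λ { zero → refl }) (λ _ → refl)
T↔Fin-indicator false = mk↔ₛ′ (λ ()) (λ ()) (λ ()) (λ ())

Σ-T↔Fin-count : (f : Fin k → Bool) → Σ (Fin k) (T ∘ f) ↔ Fin (count f)
Σ-T↔Fin-count {zero}  f = mk↔ₛ′ (λ { (() , _) }) (λ ()) (λ ()) (λ { (() , _) })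
Σ-T↔Fin-count {suc k} f =
  ↔-trans Σ-Fin-suc↔ (↔-trans (T↔Fin-indicator (f zero) ⊎-↔ Σ-T↔Fin-count (f ∘ suc)) (↔-sym +↔⊎))

↔⇒count≡ : {f : Fin m → Bool} {g : Fin k → Bool} →
  Σ (Fin m) (T ∘ f) ↔ Σ (Fin k) (T ∘ g) → count f ≡ count g
↔⇒count≡ {f = f} {g} f↔g =
  ↔⇒≡ (↔-trans (↔-sym (Σ-T↔Fin-count f)) (↔-trans f↔g (Σ-T↔Fin-count g)))

T-cong : ∀ {a b} → a ≡ b → T a ↔ T b
T-cong refl = ↔-refl

Σ-restrict↔ : {P Q : A → Set} → P ⊆ Q → (∀ {a} → Irrelevant (Q a)) →
              Σ A P ↔ Σ (Σ A Q) (P ∘ proj₁)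
Σ-restrict↔ P⊆Q Q-irr = mk↔ₛ′
  (λ (a , p) → (a , P⊆Q p) , p)
  (λ ((a , _) , p) → a , p)
  (λ ((a , q) , p) → cong (λ q′ → (a , q′) , p) (Q-irr (P⊆Q p) q))
  (λ _ → refl)

deg≡count : (G : Graph) (v : Fin (n G)) → deg G v ≡ count (adj G v)
deg≡count G v = cong sum (map-tabulate id (indicator ∘ adj G v))

inB : Part → Bool
inB pB = true
inB pA = false
inB pC = false

inB⇒≡pB : ∀ {p} → T (inB p) → p ≡ pB
inB⇒≡pB {pB} _ = refl

inB⇒InXC : T ∘ inB ⊆ InXC pB
inB⇒InXC {pB} _ = inj₁ refl

¬inB⇒InXC : T ∘ not ∘ inB ⊆ InXC pA
¬inB⇒InXC {pA} _ = inj₁ refl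
¬inB⇒InXC {pC} _ = inj₂ refl

nbhdIn : (G : Graph) → Partition G → (Part → Bool) → Fin (n G) → Fin (n G) → Bool
nbhdIn G s q v u = q (s u) ∧ adj G v u

degIn : (G : Graph) → Partition G → (Part → Bool) → Fin (n G) → ℕ
degIn G s q v = count (nbhdIn G s q v)

deg≡degIn-B+degIn-A∪C : (G : Graph) (s : Partition G) (v : Fin (n G)) →
                        deg G v ≡ degIn G s inB v + degIn G s (not ∘ inB) v
deg≡degIn-B+degIn-A∪C G s v = trans (deg≡count G v) (count-partition (inB ∘ s) (adj G v))

InXC-irrelevant : X ≢ pC → ∀ {p} → Irrelevant (InXC X p)
InXC-irrelevant X≢C (inj₁ refl) (inj₁ refl) = refl
InXC-irrelevant X≢C (inj₂ refl) (inj₂ refl) = refl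
InXC-irrelevant X≢C (inj₁ refl) (inj₂ refl) = ⊥-elim (X≢C refl)
InXC-irrelevant X≢C (inj₂ refl) (inj₁ refl) = ⊥-elim (X≢C refl)

_$ₐ_ : {B : Set} {P : A ↔ B → Set} → Σ (A ↔ B) P → A → B
φ $ₐ h = Inverse.to (proj₁ φ) h

≅ₐ-sym : {H₁ H₂ : AGraph} → H₁ ≅ₐ H₂ → H₂ ≅ₐ H₁
≅ₐ-sym {H₁} {H₂} (φ , edges , labels) =
  ↔-sym φ ,
  (λ u v → trans (sym (edges (from u) (from v))) (cong₂ (AGraph.E H₂) (strictlyInverseˡ u) (strictlyInverseˡ v))) ,
  (λ h → trans (sym (labels (from h))) (cong (AGraph.label H₂) (strictlyInverseˡ h)))
  where open Inverse φ using (from; strictlyInverseˡ)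

labelX-C : (G : Graph) (s : Partition G) (v : Fin (n G)) → s v ≡ pC → labelX G s v ≡ just (deg G v)
labelX-C G s v v∈C rewrite v∈C = refl

partOf : Part → Maybe ℕ → Part
partOf X nothing  = X
partOf X (just _) = pC

partOf-labelX : (G : Graph) (s : Partition G) (v : Fin (n G)) →
                InXC X (s v) → partOf X (labelX G s v) ≡ s v
partOf-labelX G s v v∈XC with s v | v∈XC
... | pA | inj₁ refl = refl
... | pB | inj₁ refl = refl
... | pC | _        = refl

side : (p : Part) → InXC pA p ⊎ p ≡ pB
side pA = inj₁ (inj₁ refl)
side pC = inj₁ (inj₂ refl)
side pB = inj₂ refl

A∪C≢B : ∀ {p} → InXC pA p → p ≢ pB
A∪C≢B (inj₁ refl) ()
A∪C≢B (inj₂ refl) ()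

C≢B : (s : A → Part) → ∀ {u v} → s u ≡ pC → s v ≡ pB → u ≢ v
C≢B s u∈C v∈B refl with trans (sym u∈C) v∈B
... | ()

B-nbhd-mono : (G : Graph) (s : Partition G) (R : IntervalRep G) {x : ℚ} →
              InCliqueMeet s R x → InGap s R x → ∀ {c₁ c₂} → s c₁ ≡ pC → s c₂ ≡ pC →
              r R c₁ ℚ.≤ r R c₂ → T ∘ nbhdIn G s inB c₁ ⊆ T ∘ nbhdIn G s inB c₂
B-nbhd-mono G s R x∈⋂C (_ , x<ℓB) {c₁} {c₂} c₁∈C c₂∈C r₁≤r₂ {b} b∈N₁
  with Equivalence.to T-∧ b∈N₁
... | b∈B , c₁~b with adj→meet R c₁ b (C≢B s c₁∈C (inB⇒≡pB b∈B)) (Equivalence.to T-≡ c₁~b)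
...   | y , (_ , y≤r₁) , (ℓb≤y , _) =
  Equivalence.from T-∧ (b∈B , Equivalence.from T-≡ (meet→adj R c₂ b (C≢B s c₂∈C (inB⇒≡pB b∈B))
    (ℓ R b , ℓb∈c₂ , ℚₚ.≤-refl , ℓ≤r R b)))
  where
  -- ℓ_{c₂} ≤ x < ℓ_b by cleanness, and ℓ_b ≤ y ≤ r_{c₁} ≤ r_{c₂} since c₁ meets b at y.
  ℓb∈c₂ : ℓ R c₂ ℚ.≤ ℓ R b × ℓ R b ℚ.≤ r R c₂
  ℓb∈c₂ = ℚₚ.≤-trans (proj₁ (x∈⋂C c₂ c₂∈C)) (ℚₚ.<⇒≤ (x<ℓB b (inB⇒≡pB b∈B)))
        , ℚₚ.≤-trans ℓb≤y (ℚₚ.≤-trans y≤r₁ r₁≤r₂)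

clean⇒B-nbhds-nested : (G : Graph) (s : Partition G) → IsCleanCliqueSeparation G s →
  ∀ {c₁ c₂} → s c₁ ≡ pC → s c₂ ≡ pC →
  T ∘ nbhdIn G s inB c₁ ⊆ T ∘ nbhdIn G s inB c₂ ⊎ T ∘ nbhdIn G s inB c₂ ⊆ T ∘ nbhdIn G s inB c₁
clean⇒B-nbhds-nested G s (_ , R , (x , x∈⋂C) , gap) {c₁} {c₂} c₁∈C c₂∈C =
  Sum.map (mono c₁∈C c₂∈C) (mono c₂∈C c₁∈C) (ℚₚ.≤-total (r R c₁) (r R c₂))
  where
  mono : ∀ {c c′} → s c ≡ pC → s c′ ≡ pC → r R c ℚ.≤ r R c′ →
         T ∘ nbhdIn G s inB c ⊆ T ∘ nbhdIn G s inB c′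
  mono = B-nbhd-mono G s R x∈⋂C (gap x x∈⋂C)

clean⇒B-nbrs-determined-by-B-degree : (G : Graph) (s : Partition G) → IsCleanCliqueSeparation G s →
  ∀ {c₁ c₂} → s c₁ ≡ pC → s c₂ ≡ pC → degIn G s inB c₁ ≡ degIn G s inB c₂ →
  ∀ {b} → s b ≡ pB → adj G c₁ b ≡ adj G c₂ b
clean⇒B-nbrs-determined-by-B-degree G s clean {c₁} {c₂} c₁∈C c₂∈C eq {b} b∈B = at-b (N₁≗N₂ b)
  where
  N₁≗N₂ : nbhdIn G s inB c₁ ≗ nbhdIn G s inB c₂
  N₁≗N₂ with clean⇒B-nbhds-nested G s clean c₁∈C c₂∈C
  ... | inj₁ N₁⊆N₂ = ⊆∧count≡⇒≗ N₁⊆N₂ eq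
  ... | inj₂ N₂⊆N₁ = sym ∘ ⊆∧count≡⇒≗ N₂⊆N₁ (sym eq)

  at-b : nbhdIn G s inB c₁ b ≡ nbhdIn G s inB c₂ b → adj G c₁ b ≡ adj G c₂ b
  at-b rewrite b∈B = id

module Transfer (G G' : Graph) (s : Partition G) (s' : Partition G') where

  ≅ₐ-part : (φ : H G s X ≅ₐ H G' s' X) (h : V (H G s X)) → s' (proj₁ (φ $ₐ h)) ≡ s (proj₁ h)
  ≅ₐ-part {X} φ h@(v , v∈XC) = begin
    s' (proj₁ (φ $ₐ h))                        ≡⟨ partOf-labelX G' s' _ (proj₂ (φ $ₐ h)) ⟨
    partOf X (labelX G' s' (proj₁ (φ $ₐ h)))  ≡⟨ cong (partOf X) (proj₂ (proj₂ φ) h) ⟩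
    partOf X (labelX G s v)                    ≡⟨ partOf-labelX G s v v∈XC ⟩
    s v                                        ∎
    where open ≡-Reasoning

  ≅ₐ-deg : (φ : H G s X ≅ₐ H G' s' X) (h : V (H G s X)) → s (proj₁ h) ≡ pC →
           deg G' (proj₁ (φ $ₐ h)) ≡ deg G (proj₁ h)
  ≅ₐ-deg φ h h∈C = just-injective (begin
    just (deg G' (proj₁ (φ $ₐ h)))  ≡⟨ labelX-C G' s' (proj₁ (φ $ₐ h)) (trans (≅ₐ-part φ h) h∈C) ⟨
    labelX G' s' (proj₁ (φ $ₐ h))   ≡⟨ proj₂ (proj₂ φ) h ⟩
    labelX G s (proj₁ h)            ≡⟨ labelX-C G s (proj₁ h) h∈C ⟩
    just (deg G (proj₁ h))          ∎)
    where open ≡-Reasoning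

  ≅ₐ-degIn : X ≢ pC → (φ : H G s X ≅ₐ H G' s' X) (q : Part → Bool) → T ∘ q ⊆ InXC X →
             (h : V (H G s X)) → degIn G s q (proj₁ h) ≡ degIn G' s' q (proj₁ (φ $ₐ h))
  ≅ₐ-degIn {X} X≢C φ@(ψ , edges , _) q q⊆XC h = ↔⇒count≡
    (↔-trans (Σ-restrict↔ (nbhd⊆XC G s) (InXC-irrelevant X≢C))
    (↔-trans (Σ-↔ ψ (λ {x} → T-cong (cong₂ _∧_ (cong q (sym (≅ₐ-part φ x))) (sym (edges h x)))))
             (↔-sym (Σ-restrict↔ (nbhd⊆XC G' s') (InXC-irrelevant X≢C)))))
    where
    nbhd⊆XC : ∀ G s {v} → T ∘ nbhdIn G s q v ⊆ InXC X ∘ s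
    nbhd⊆XC G s = q⊆XC ∘ proj₁ ∘ Equivalence.to T-∧

  glue : (V (H G s pA) → V (H G' s' pA)) → (V (H G s pB) → V (H G' s' pB)) → Fin (n G) → Fin (n G')
  glue fA fB v with side (s v)
  ... | inj₁ v∈AC = proj₁ (fA (v , v∈AC))
  ... | inj₂ v∈B  = proj₁ (fB (v , inj₁ v∈B))

  glue-A∪C : ∀ fA fB (x : V (H G s pA)) → glue fA fB (proj₁ x) ≡ proj₁ (fA x)
  glue-A∪C fA fB (v , v∈AC) with side (s v)
  ... | inj₁ v∈AC′ = cong (λ p → proj₁ (fA (v , p))) (InXC-irrelevant (λ ()) v∈AC′ v∈AC)
  ... | inj₂ v∈B   = ⊥-elim (A∪C≢B v∈AC v∈B)

  glue-B : ∀ fA fB (x : V (H G s pB)) → s (proj₁ x) ≡ pB → glue fA fB (proj₁ x) ≡ proj₁ (fB x)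
  glue-B fA fB (v , v∈BC) v∈B with side (s v)
  ... | inj₁ v∈AC = ⊥-elim (A∪C≢B v∈AC v∈B)
  ... | inj₂ v∈B′ = cong (λ p → proj₁ (fB (v , p))) (InXC-irrelevant (λ ()) (inj₁ v∈B′) v∈BC)

  ≅ₐ-A-degIn-B : (φA : H G s pA ≅ₐ H G' s' pA) (c : Fin (n G)) (c∈C : s c ≡ pC) →
                 degIn G' s' inB (proj₁ (φA $ₐ (c , inj₂ c∈C))) ≡ degIn G s inB c
  ≅ₐ-A-degIn-B φA c c∈C = ℕ.+-cancelʳ-≡ (degIn G s (not ∘ inB) c) _ _ (begin
    degIn G' s' inB c′ + degIn G s (not ∘ inB) c
      ≡⟨ cong (degIn G' s' inB c′ +_) (≅ₐ-degIn (λ ()) φA (not ∘ inB) ¬inB⇒InXC (c , inj₂ c∈C)) ⟩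
    degIn G' s' inB c′ + degIn G' s' (not ∘ inB) c′   ≡⟨ deg≡degIn-B+degIn-A∪C G' s' c′ ⟨
    deg G' c′                                         ≡⟨ ≅ₐ-deg φA (c , inj₂ c∈C) c∈C ⟩
    deg G c                                           ≡⟨ deg≡degIn-B+degIn-A∪C G s c ⟩
    degIn G s inB c + degIn G s (not ∘ inB) c         ∎)
    where
    c′ : Fin (n G')
    c′ = proj₁ (φA $ₐ (c , inj₂ c∈C))
    open ≡-Reasoning

  module _ (sep : IsSeparation G s) (clean′ : IsCleanCliqueSeparation G' s')
           (φA : H G s pA ≅ₐ H G' s' pA) (φB : H G s pB ≅ₐ H G' s' pB) where

    glue-adj-A∪C-B : ∀ {u v} (u∈AC : InXC pA (s u)) (v∈B : s v ≡ pB) →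
      adj G' (proj₁ (φA $ₐ (u , u∈AC))) (proj₁ (φB $ₐ (v , inj₁ v∈B))) ≡ adj G u v
    glue-adj-A∪C-B (inj₁ u∈A) v∈B =
      trans (proj₁ clean′ _ _ (trans (≅ₐ-part φA _) u∈A) (trans (≅ₐ-part φB _) v∈B))
            (sym (sep _ _ u∈A v∈B))
    glue-adj-A∪C-B {u} {v} (inj₂ u∈C) v∈B = begin
      adj G' (proj₁ (φA $ₐ (u , inj₂ u∈C))) v′
        ≡⟨ clean⇒B-nbrs-determined-by-B-degree G' s' clean′
             (trans (≅ₐ-part φA _) u∈C) (trans (≅ₐ-part φB _) u∈C)
             (trans (≅ₐ-A-degIn-B φA u u∈C) (≅ₐ-degIn (λ ()) φB inB inB⇒InXC (u , inj₂ u∈C)))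
             (trans (≅ₐ-part φB _) v∈B) ⟩
      adj G' (proj₁ (φB $ₐ (u , inj₂ u∈C))) v′  ≡⟨ proj₁ (proj₂ φB) (u , inj₂ u∈C) (v , inj₁ v∈B) ⟩
      adj G u v                                 ∎
      where
      v′ : Fin (n G')
      v′ = proj₁ (φB $ₐ (v , inj₁ v∈B))
      open ≡-Reasoning

    glue-adj : ∀ u v → adj G' (glue (φA $ₐ_) (φB $ₐ_) u) (glue (φA $ₐ_) (φB $ₐ_) v) ≡ adj G u v
    glue-adj u v with side (s u) | side (s v)
    ... | inj₁ u∈AC | inj₁ v∈AC = proj₁ (proj₂ φA) (u , u∈AC) (v , v∈AC)
    ... | inj₂ u∈B  | inj₂ v∈B  = proj₁ (proj₂ φB) (u , inj₁ u∈B) (v , inj₁ v∈B)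
    ... | inj₁ u∈AC | inj₂ v∈B  = glue-adj-A∪C-B u∈AC v∈B
    ... | inj₂ u∈B  | inj₁ v∈AC =
      trans (Graph.sym G' _ _) (trans (glue-adj-A∪C-B v∈AC u∈B) (Graph.sym G v u))

glue-inverse : (G G' : Graph) (s : Partition G) (s' : Partition G')
  (fA : V (H G s pA) → V (H G' s' pA)) (fB : V (H G s pB) → V (H G' s' pB))
  (gA : V (H G' s' pA) → V (H G s pA)) (gB : V (H G' s' pB) → V (H G s pB)) →
  (∀ x → s' (proj₁ (fB x)) ≡ s (proj₁ x)) → (∀ x → gA (fA x) ≡ x) → (∀ x → gB (fB x) ≡ x) →
  ∀ v → Transfer.glue G' G s' s gA gB (Transfer.glue G G' s s' fA fB v) ≡ v
glue-inverse G G' s s' fA fB gA gB fB-part gA∘fA gB∘fB v with side (s v)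
... | inj₁ v∈AC = trans (Transfer.glue-A∪C G' G s' s gA gB (fA (v , v∈AC)))
                        (cong proj₁ (gA∘fA (v , v∈AC)))
... | inj₂ v∈B  = trans (Transfer.glue-B G' G s' s gA gB (fB (v , inj₁ v∈B)) (trans (fB-part _) v∈B))
                        (cong proj₁ (gB∘fB (v , inj₁ v∈B)))

lemma25 : (G G' : Graph) (s : Partition G) (s' : Partition G') →
    IsCleanCliqueSeparation G s → IsCleanCliqueSeparation G' s' →
    H G s pA ≅ₐ H G' s' pA → H G s pB ≅ₐ H G' s' pB → G ≅ G'
lemma25 G G' s s' clean clean′ φA φB =
  mk↔ₛ′ (glue (φA $ₐ_) (φB $ₐ_)) (Back.glue (φA⁻¹ $ₐ_) (φB⁻¹ $ₐ_))
    (glue-inverse G' G s' s (φA⁻¹ $ₐ_) (φB⁻¹ $ₐ_) (φA $ₐ_) (φB $ₐ_)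
       (Back.≅ₐ-part φB⁻¹) (Inverse.strictlyInverseˡ (proj₁ φA)) (Inverse.strictlyInverseˡ (proj₁ φB)))
    (glue-inverse G G' s s' (φA $ₐ_) (φB $ₐ_) (φA⁻¹ $ₐ_) (φB⁻¹ $ₐ_)
       (≅ₐ-part φB) (Inverse.strictlyInverseʳ (proj₁ φA)) (Inverse.strictlyInverseʳ (proj₁ φB))) ,
  glue-adj (proj₁ clean) clean′ φA φB
  where
  open Transfer G G' s s'
  module Back = Transfer G' G s' s
  φA⁻¹ : H G' s' pA ≅ₐ H G s pA
  φA⁻¹ = ≅ₐ-sym φA
  φB⁻¹ : H G' s' pB ≅ₐ H G s pB
  φB⁻¹ = ≅ₐ-sym φB
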